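{- Let $m,q\ge2$ be integers. Let $\bm H_{m,q}=(h_{ij})_{i,j\ge0}$ be the infinite matrix with $h_{00}=(m-1)/(q-1)$, $h_{0j}=0$ for $j\ge1$, and, for $i\ge1$, $h_{i0}+h_{i1}x+\cdots+h_{ii}x^i$ equal to the $h$-polynomial of $\Delta^{(i-1)}_{m,q}$ and $h_{ij}=0$ for $j\ge i+1$. Then $\bm H_{m,q}=\widetilde{\bm F}_{m-1,q-1}$, where for positive integers $a,b$, $\widetilde{\bm F}_{a,b}=(d_{n,k})$ is the matrix with $d_{0,0}=a/b$, $d_{0,k}=0$ for $k\geq 1$, and whose $n$-th row ($n\ge1$) is the extended $f$-vector of $\Delta^{(n-1)}_{a,b}$ followed by zeros.
   Context: $[k]$ is the $0$-dimensional simplicial complex with $k$ vertices; the join is $\mathcal F*\mathcal K=\{\sigma\cup\tau:\sigma\in\mathcal F\cup\{\emptyset\},\tau\in\mathcal K\cup\{\emptyset\}\}$ on disjoint vertex sets. $\Delta^{(0)}_{a,b}=[a]$ and $\Delta^{(n)}_{a,b}=\Delta^{(n-1)}_{a,b}*[b]$. For a $d$-dimensional complex with $f_k$ faces of dimension $k$ and $f_{ -1}=1$, the extended $f$-vector is $(f_{ -1},\ldots,f_d)$ and the $h$-polynomial is $\sum_{k=0}^{d+1}h_kx^k$ with $h_k=\sum_{i=0}^k(-1)^{k-i}\binom{d+1-i}{d+1-k}f_{i-1}$. -}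

module Defs where

open import Data.Nat using (ℕ; zero; suc; _+_; _∸_; _⊔_; _≤?_; NonZero)
open import Data.Nat.Combinatorics using (_C_)
open import Data.Integer as ℤ using (ℤ; +_)
open import Data.Rational as ℚ using (ℚ; _/_)
open import Data.List using (List; []; _∷_; map; filter; length; upTo; concatMap; foldr)
open import Relation.Nullary.Decidable using (⌊_⌋)
open import Data.Bool using (if_then_else_)

-- A finite simplicial complex on the vertex set {0,…,nverts-1}, given by the
-- list of its NONEMPTY faces (each face a list of vertices).  The empty face
-- is implicit (f_{-1} = 1).
record Complex : Set where
  constructor mkComplex
  field
    nverts : ℕ
    faces  : List (List ℕ)
open Complex public

pts : ℕ → Complex
pts k = mkComplex k (map (λ v → v ∷ []) (upTo k))

-- join F * K, with the vertices of K shifted by nverts F (disjoint vertex sets):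
-- faces σ ∪ τ with σ ∈ F ∪ {∅}, τ ∈ K ∪ {∅}; the empty one is dropped (implicit).
join : Complex → Complex → Complex
join F K = mkComplex (nverts F + nverts K)
  (filter (λ σ → 1 ≤? length σ)
    (concatMap (λ σ → map (λ τ → σ Data.List.++ map (λ v → nverts F + v) τ) ([] ∷ faces K))
               ([] ∷ faces F)))

Δ : ℕ → ℕ → ℕ → Complex
Δ zero    a b = pts a
Δ (suc n) a b = join (Δ n a b) (pts b)

-- d + 1, where d is the dimension (maximal face size)
rank : Complex → ℕ
rank K = foldr _⊔_ 0 (map length (faces K))

-- fExt K i = f_{i-1}(K): number of faces with exactly i vertices (fExt K 0 = 1)
fExt : Complex → ℕ → ℕ
fExt K zero    = 1
fExt K (suc i) = length (filter (λ σ → length σ Data.Nat.≟ suc i) (faces K))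

sgn : ℕ → ℤ
sgn zero    = + 1
sgn (suc n) = ℤ.- sgn n

sumℤ : List ℤ → ℤ
sumℤ = foldr ℤ._+_ (+ 0)

hCoeff : Complex → ℕ → ℤ
hCoeff K k = sumℤ (map (λ i → sgn (k ∸ i) ℤ.* (+ (((rank K ∸ i) C (rank K ∸ k)) Data.Nat.* fExt K i)))
                       (upTo (suc k)))

Hmat : (m q : ℕ) → .{{NonZero (q ∸ 1)}} → ℕ → ℕ → ℚ
Hmat m q zero    zero    = (+ (m ∸ 1)) / (q ∸ 1)
Hmat m q zero    (suc j) = ℚ.0ℚ
Hmat m q (suc n) j =
  if ⌊ j ≤? suc n ⌋ then ℚ._/_ (hCoeff (Δ n m q) j) 1 else ℚ.0ℚ

Ftilde : (a b : ℕ) → .{{NonZero b}} → ℕ → ℕ → ℚ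
Ftilde a b zero    zero    = (+ a) / b
Ftilde a b zero    (suc k) = ℚ.0ℚ
Ftilde a b (suc n) k =
  if ⌊ k ≤? rank (Δ n a b) ⌋ then (+ fExt (Δ n a b) k) / 1 else ℚ.0ℚ

-- The f-polynomial Σᵢ f_{i-1} xⁱ of Δ^{(n)}_{a,b} is (1 + a x)(1 + b x)ⁿ, since joining with [b]
-- multiplies it by 1 + b x, and the h-polynomial of a complex of dimension d is
-- Σᵢ f_{i-1} xⁱ (1 - x)^{d+1-i}. Substituting, the h-polynomial of Δ^{(n)}_{m,q} is
-- (1 + (m-1) x)(1 + (q-1) x)ⁿ, the f-polynomial of Δ^{(n)}_{m-1,q-1}; as m, q ≥ 2 both complexes have
-- dimension n, so the two rows also have the same length. The substitution is done by induction on n: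
-- the transform of rank r + 1 sends (1 + (c+1) x) g to (1 + c x) times the rank-r transform of g,
-- because raising the rank multiplies by 1 - x and the transform commutes with multiplication by x.

module Submission where

open import Defs
open import Data.Bool using (true; false; if_then_else_)
open import Data.Nat using (ℕ; zero; suc; _≤_; _<_; _∸_; _≟_; _≤?_; NonZero; z≤n; s≤s)
import Data.Rational as ℚ
open import Function using (_∘_)
open import Relation.Binary.PropositionalEquality
  using (_≡_; _≗_; refl; sym; trans; cong; cong₂; subst; module ≡-Reasoning)
open import Relation.Nullary using (Dec; does; yes; no)

δ : ℕ → ℕ → ℕ
δ m n = if does (m ≟ n) then 1 else 0

module Coefficients where

  open import Data.Integer using (ℤ; +_; _+_; _*_; -_; 1ℤ; -1ℤ)
  import Data.Integer.Properties as ℤₚ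
  open import Data.Integer.Tactic.RingSolver using (solve-∀)
  import Data.Nat as ℕ
  import Data.Nat.Properties as ℕₚ
  open import Data.Nat.Combinatorics using (_C_; nCk≡nC[n∸k]; nCn≡1; nC1≡n; nCk+nC[k+1]≡[n+1]C[k+1])
  open import Data.List using (map; upTo; applyUpTo; _∷_)
  open import Data.List.Properties using (map-applyUpTo)
  open ≡-Reasoning

  DegreeAtMost : ℕ → (ℕ → ℤ) → Set
  DegreeAtMost d f = ∀ i → d < i → f i ≡ + 0

  -- A sequence f : ℕ → ℤ stands for the polynomial Σᵢ f i xⁱ; shiftCoeffs is multiplication by x
  -- and mulOnePlus c multiplication by 1 + c x.
  one : ℕ → ℤ
  one i = + δ 0 i

  shiftCoeffs : (ℕ → ℤ) → ℕ → ℤ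
  shiftCoeffs f zero    = + 0
  shiftCoeffs f (suc i) = f i

  mulOnePlus : ℤ → (ℕ → ℤ) → ℕ → ℤ
  mulOnePlus c f i = f i + c * shiftCoeffs f i

  mulOnePlus-zero : ∀ c f → mulOnePlus c f 0 ≡ f 0
  mulOnePlus-zero c f = trans (cong (λ x → f 0 + x) (ℤₚ.*-zeroʳ c)) (ℤₚ.+-identityʳ (f 0))

  mulOnePlus-cong : ∀ c {f g} → f ≗ g → mulOnePlus c f ≗ mulOnePlus c g
  mulOnePlus-cong c f≗g zero    = cong (_+ c * + 0) (f≗g 0)
  mulOnePlus-cong c f≗g (suc i) = cong₂ (λ u v → u + c * v) (f≗g (suc i)) (f≗g i)

  one-degree : DegreeAtMost 0 one
  one-degree (suc i) _ = refl

  mulOnePlus-degree : ∀ {d f} c → DegreeAtMost d f → DegreeAtMost (suc d) (mulOnePlus c f)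
  mulOnePlus-degree {d} {f} c deg (suc i) (s≤s d<i) = begin
    f (suc i) + c * f i  ≡⟨ cong₂ (λ u v → u + c * v) (deg (suc i) (ℕₚ.m<n⇒m<1+n d<i)) (deg i d<i) ⟩
    + 0 + c * + 0        ≡⟨ cong (λ x → + 0 + x) (ℤₚ.*-zeroʳ c) ⟩
    + 0                  ∎

  -- For k ≤ r, hTransform r f k = Σ_{i ≤ k} (-1)^{k-i} C(r-i, k-i) f i, the coefficient of xᵏ in
  -- Σᵢ f i xⁱ (1 - x)^{r-i}. For k > r it returns f k, which is that coefficient when f has degree ≤ r.
  hTransform : ℕ → (ℕ → ℤ) → ℕ → ℤ
  hTransform zero    f k       = f k
  hTransform (suc r) f zero    = f 0
  hTransform (suc r) f (suc k) = sgn (suc k) * (+ (suc r C suc k) * f 0) + hTransform r (f ∘ suc) k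

  hTransform-zero : ∀ r f → hTransform r f 0 ≡ f 0
  hTransform-zero zero    f = refl
  hTransform-zero (suc r) f = refl

  hTransform-cong : ∀ r {f g} → f ≗ g → hTransform r f ≗ hTransform r g
  hTransform-cong zero    f≗g k       = f≗g k
  hTransform-cong (suc r) f≗g zero    = f≗g 0
  hTransform-cong (suc r) f≗g (suc k) =
    cong₂ (λ u v → sgn (suc k) * (+ (suc r C suc k) * u) + v) (f≗g 0) (hTransform-cong r (f≗g ∘ suc) k)

  hTransform-linear : ∀ r f g c →
                      hTransform r (λ i → f i + c * g i) ≗ λ k → hTransform r f k + c * hTransform r g k
  hTransform-linear zero    f g c k       = refl
  hTransform-linear (suc r) f g c zero    = refl
  hTransform-linear (suc r) f g c (suc k) =
    trans (cong (λ v → sgn (suc k) * (+ (suc r C suc k) * (f 0 + c * g 0)) + v)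
                (hTransform-linear r (f ∘ suc) (g ∘ suc) c k))
          (distribute (sgn (suc k)) (+ (suc r C suc k)) (f 0) (g 0) c
                      (hTransform r (f ∘ suc) k) (hTransform r (g ∘ suc) k))
    where
    distribute : ∀ s b x y c u v →
                 s * (b * (x + c * y)) + (u + c * v) ≡ (s * (b * x) + u) + c * (s * (b * y) + v)
    distribute = solve-∀

  hTransform-shift : ∀ r g → hTransform (suc r) (shiftCoeffs g) ≗ shiftCoeffs (hTransform r g)
  hTransform-shift r g zero    = refl
  hTransform-shift r g (suc k) = begin
    sgn (suc k) * (+ (suc r C suc k) * + 0) + hTransform r g k
      ≡⟨ cong (λ x → sgn (suc k) * x + hTransform r g k) (ℤₚ.*-zeroʳ (+ (suc r C suc k))) ⟩
    sgn (suc k) * + 0 + hTransform r g k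
      ≡⟨ cong (λ x → x + hTransform r g k) (ℤₚ.*-zeroʳ (sgn (suc k))) ⟩
    + 0 + hTransform r g k
      ≡⟨ ℤₚ.+-identityˡ (hTransform r g k) ⟩
    hTransform r g k
      ∎

  -- The term f (r + 1) xʳ⁺¹ of the rank-(r + 1) transform has no rank-r counterpart, hence the degree bound.
  hTransform-suc : ∀ r f → DegreeAtMost r f → hTransform (suc r) f ≗ mulOnePlus -1ℤ (hTransform r f)
  hTransform-suc r f deg zero = sym (trans (ℤₚ.+-identityʳ (hTransform r f 0)) (hTransform-zero r f))
  hTransform-suc zero f deg (suc zero) = swap (f 0) (f 1)
    where
    swap : ∀ x y → -1ℤ * (1ℤ * x) + y ≡ y + -1ℤ * x
    swap = solve-∀
  hTransform-suc zero f deg (suc (suc k))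
    rewrite deg (suc (suc k)) (s≤s z≤n) | deg (suc k) (s≤s z≤n) = vanish (sgn (suc (suc k))) (f 0)
    where
    vanish : ∀ s x → s * (+ 0 * x) + + 0 ≡ + 0 + -1ℤ * + 0
    vanish = solve-∀
  hTransform-suc (suc r) f deg (suc zero)
    rewrite nC1≡n (suc (suc r)) | nC1≡n (suc r) | hTransform-zero r (f ∘ suc) = first (+ suc r) (f 0) (f 1)
    where
    first : ∀ n x y → -1ℤ * ((1ℤ + n) * x) + y ≡ (-1ℤ * (n * x) + y) + -1ℤ * x
    first = solve-∀
  hTransform-suc (suc r) f deg (suc (suc k)) =
    trans (cong₂ (λ c h → sgn (suc (suc k)) * (+ c * f 0) + h)
                 (sym (nCk+nC[k+1]≡[n+1]C[k+1] (suc r) (suc k)))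
                 (hTransform-suc r (f ∘ suc) (λ i r<i → deg (suc i) (s≤s r<i)) (suc k)))
          (pascal (sgn (suc k)) (+ (suc r C suc k)) (+ (suc r C suc (suc k))) (f 0)
                  (hTransform r (f ∘ suc) (suc k)) (hTransform r (f ∘ suc) k))
    where
    pascal : ∀ s a b x u v →
             - s * ((a + b) * x) + (u + -1ℤ * v) ≡ (- s * (b * x) + u) + -1ℤ * (s * (a * x) + v)
    pascal = solve-∀

  hTransform-mulOnePlus : ∀ r c f → DegreeAtMost r f →
                          hTransform (suc r) (mulOnePlus (1ℤ + c) f) ≗ mulOnePlus c (hTransform r f)
  hTransform-mulOnePlus r c f deg k = begin
    hTransform (suc r) (mulOnePlus (1ℤ + c) f) k
      ≡⟨ hTransform-linear (suc r) f (shiftCoeffs f) (1ℤ + c) k ⟩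
    hTransform (suc r) f k + (1ℤ + c) * hTransform (suc r) (shiftCoeffs f) k
      ≡⟨ cong₂ (λ u v → u + (1ℤ + c) * v) (hTransform-suc r f deg k) (hTransform-shift r f k) ⟩
    mulOnePlus -1ℤ h k + (1ℤ + c) * shiftCoeffs h k
      ≡⟨ regroup (h k) (shiftCoeffs h k) c ⟩
    mulOnePlus c h k
      ∎
    where
    h : ℕ → ℤ
    h = hTransform r f
    regroup : ∀ u v c → (u + -1ℤ * v) + (1ℤ + c) * v ≡ u + c * v
    regroup = solve-∀

  fPolyΔ : ℤ → ℤ → ℕ → ℕ → ℤ
  fPolyΔ a b zero    = mulOnePlus a one
  fPolyΔ a b (suc n) = mulOnePlus b (fPolyΔ a b n)

  fPolyΔ-degree : ∀ a b n → DegreeAtMost (suc n) (fPolyΔ a b n)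
  fPolyΔ-degree a b zero    = mulOnePlus-degree a one-degree
  fPolyΔ-degree a b (suc n) = mulOnePlus-degree b (fPolyΔ-degree a b n)

  hTransform-fPolyΔ : ∀ a b n → hTransform (suc n) (fPolyΔ (1ℤ + a) (1ℤ + b) n) ≗ fPolyΔ a b n
  hTransform-fPolyΔ a b zero    = hTransform-mulOnePlus 0 a one one-degree
  hTransform-fPolyΔ a b (suc n) k =
    trans (hTransform-mulOnePlus (suc n) b _ (fPolyΔ-degree (1ℤ + a) (1ℤ + b) n) k)
          (mulOnePlus-cong b (hTransform-fPolyΔ a b n) k)

  -- hCoeff K k unfolds to hFormula (rank K) k (fExt K).
  hFormula : ℕ → ℕ → (ℕ → ℕ) → ℤ
  hFormula r k f = sumℤ (map (λ i → sgn (k ∸ i) * + (((r ∸ i) C (r ∸ k)) ℕ.* f i)) (upTo (suc k)))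

  hFormula≡hTransform : ∀ r k f → k ≤ r → hFormula r k f ≡ hTransform r (+_ ∘ f) k
  hFormula≡hTransform r zero f _ = begin
    (1ℤ * + ((r C r) ℕ.* f 0)) + + 0 ≡⟨ ℤₚ.+-identityʳ _ ⟩
    1ℤ * + ((r C r) ℕ.* f 0)         ≡⟨ ℤₚ.*-identityˡ _ ⟩
    + ((r C r) ℕ.* f 0)              ≡⟨ cong (λ c → + (c ℕ.* f 0)) (nCn≡1 r) ⟩
    + (1 ℕ.* f 0)                    ≡⟨ cong +_ (ℕₚ.*-identityˡ (f 0)) ⟩
    + f 0                            ≡⟨ sym (hTransform-zero r (+_ ∘ f)) ⟩
    hTransform r (+_ ∘ f) 0          ∎
  hFormula≡hTransform (suc r) (suc k) f (s≤s k≤r) = begin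
    hFormula (suc r) (suc k) f
      ≡⟨ cong (λ l → sumℤ (term 0 ∷ l)) (map-upTo-suc (suc k)) ⟩
    term 0 + hFormula r k (f ∘ suc)
      ≡⟨ cong₂ (λ c h → sgn (suc k) * + (c ℕ.* f 0) + h)
               (sym (nCk≡nC[n∸k] (s≤s k≤r))) (hFormula≡hTransform r k (f ∘ suc) k≤r) ⟩
    sgn (suc k) * + ((suc r C suc k) ℕ.* f 0) + hTransform r (+_ ∘ f ∘ suc) k
      ≡⟨ cong (λ x → sgn (suc k) * x + hTransform r (+_ ∘ f ∘ suc) k)
              (ℤₚ.pos-* (suc r C suc k) (f 0)) ⟩
    hTransform (suc r) (+_ ∘ f) (suc k)
      ∎
    where
    term : ℕ → ℤ
    term i = sgn (suc k ∸ i) * + (((suc r ∸ i) C (suc r ∸ suc k)) ℕ.* f i)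
    map-upTo-suc : ∀ n → map term (applyUpTo suc n) ≡ map (term ∘ suc) (upTo n)
    map-upTo-suc n = trans (map-applyUpTo suc term n) (sym (map-applyUpTo (λ i → i) (term ∘ suc) n))

module Faces where

  open import Data.Nat using (_+_; _*_; _⊔_)
  import Data.Nat.Properties as ℕₚ
  open import Data.Nat.Tactic.RingSolver using (solve-∀)
  open import Data.List using (List; []; _∷_; [_]; _++_; map; filter; length; foldr; upTo; applyUpTo; concatMap)
  open import Data.List.Properties using (length-++; length-upTo; ++-identityʳ; map-∘; concatMap-cong)
  open ≡-Reasoning

  nonempty : (σ : List ℕ) → Dec (1 ≤ length σ)
  nonempty σ = 1 ≤? length σ

  numFaces : ℕ → List (List ℕ) → ℕ
  numFaces j L = length (filter (λ σ → length σ ≟ j) L)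

  maxSize : List (List ℕ) → ℕ
  maxSize L = foldr _⊔_ 0 (map length L)

  extend : ℕ → ℕ → List ℕ → List (List ℕ)
  extend c b σ = σ ∷ map (λ v → σ ++ [ c + v ]) (upTo b)

  faces-join-pts : ∀ K b →
                   faces (join K (pts b)) ≡ filter nonempty (concatMap (extend (nverts K) b) ([] ∷ faces K))
  faces-join-pts K b = cong (filter nonempty) (concatMap-cong extend-faces ([] ∷ faces K))
    where
    extend-faces : ∀ σ →
                   map (λ τ → σ ++ map (nverts K +_) τ) ([] ∷ map [_] (upTo b)) ≡ extend (nverts K) b σ
    extend-faces σ = cong₂ _∷_ (++-identityʳ σ) (sym (map-∘ (upTo b)))

  length-extension : ∀ c σ v → length (σ ++ [ c + v ]) ≡ suc (length σ)
  length-extension c σ v = trans (length-++ σ) (ℕₚ.+-comm (length σ) 1)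

  numFaces-∷ : ∀ j σ L → numFaces j (σ ∷ L) ≡ δ (length σ) j + numFaces j L
  numFaces-∷ j σ L with does (length σ ≟ j)
  ... | true  = refl
  ... | false = refl

  numFaces-++ : ∀ j L M → numFaces j (L ++ M) ≡ numFaces j L + numFaces j M
  numFaces-++ j []      M = refl
  numFaces-++ j (σ ∷ L) M = begin
    numFaces j (σ ∷ L ++ M)                         ≡⟨ numFaces-∷ j σ (L ++ M) ⟩
    δ (length σ) j + numFaces j (L ++ M)            ≡⟨ cong (δ (length σ) j +_) (numFaces-++ j L M) ⟩
    δ (length σ) j + (numFaces j L + numFaces j M)  ≡⟨ ℕₚ.+-assoc (δ (length σ) j) _ _ ⟨
    δ (length σ) j + numFaces j L + numFaces j M    ≡⟨ cong (_+ numFaces j M) (numFaces-∷ j σ L) ⟨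
    numFaces j (σ ∷ L) + numFaces j M               ∎

  numFaces-map : ∀ j l (g : ℕ → List ℕ) → (∀ v → length (g v) ≡ l) →
                 ∀ vs → numFaces j (map g vs) ≡ length vs * δ l j
  numFaces-map j l g len []       = refl
  numFaces-map j l g len (v ∷ vs) = begin
    numFaces j (g v ∷ map g vs)
      ≡⟨ numFaces-∷ j (g v) (map g vs) ⟩
    δ (length (g v)) j + numFaces j (map g vs)
      ≡⟨ cong₂ (λ x y → δ x j + y) (len v) (numFaces-map j l g len vs) ⟩
    δ l j + length vs * δ l j
      ∎

  numFaces-pts : ∀ j a → numFaces j (faces (pts a)) ≡ a * δ 1 j
  numFaces-pts j a = trans (numFaces-map j 1 [_] (λ _ → refl) (upTo a)) (cong (_* δ 1 j) (length-upTo a))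

  numFaces-nonempty : ∀ i L → numFaces (suc i) (filter nonempty L) ≡ numFaces (suc i) L
  numFaces-nonempty i []            = refl
  numFaces-nonempty i ([] ∷ L)      = numFaces-nonempty i L
  numFaces-nonempty i (σ@(_ ∷ _) ∷ L) = begin
    numFaces (suc i) (σ ∷ filter nonempty L)
      ≡⟨ numFaces-∷ (suc i) σ _ ⟩
    δ (length σ) (suc i) + numFaces (suc i) (filter nonempty L)
      ≡⟨ cong (δ (length σ) (suc i) +_) (numFaces-nonempty i L) ⟩
    δ (length σ) (suc i) + numFaces (suc i) L
      ≡⟨ numFaces-∷ (suc i) σ L ⟨
    numFaces (suc i) (σ ∷ L)
      ∎

  numFaces-zero-nonempty : ∀ L → numFaces 0 (filter nonempty L) ≡ 0
  numFaces-zero-nonempty []            = refl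
  numFaces-zero-nonempty ([] ∷ L)      = numFaces-zero-nonempty L
  numFaces-zero-nonempty ((_ ∷ _) ∷ L) = numFaces-zero-nonempty L

  numFaces-extend : ∀ j c b σ → numFaces j (extend c b σ) ≡ δ (length σ) j + b * δ (suc (length σ)) j
  numFaces-extend j c b σ = begin
    numFaces j (extend c b σ)
      ≡⟨ numFaces-∷ j σ _ ⟩
    δ (length σ) j + numFaces j (map (λ v → σ ++ [ c + v ]) (upTo b))
      ≡⟨ cong (δ (length σ) j +_) (numFaces-map j (suc (length σ)) _ (length-extension c σ) (upTo b)) ⟩
    δ (length σ) j + length (upTo b) * δ (suc (length σ)) j
      ≡⟨ cong (λ n → δ (length σ) j + n * δ (suc (length σ)) j) (length-upTo b) ⟩
    δ (length σ) j + b * δ (suc (length σ)) j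
      ∎

  numFaces-concatMap-extend : ∀ i c b L →
    numFaces (suc i) (concatMap (extend c b) L) ≡ numFaces (suc i) L + b * numFaces i L
  numFaces-concatMap-extend i c b []      = sym (ℕₚ.*-zeroʳ b)
  numFaces-concatMap-extend i c b (σ ∷ L) = begin
    numFaces (suc i) (extend c b σ ++ concatMap (extend c b) L)
      ≡⟨ numFaces-++ (suc i) (extend c b σ) _ ⟩
    numFaces (suc i) (extend c b σ) + numFaces (suc i) (concatMap (extend c b) L)
      ≡⟨ cong₂ _+_ (numFaces-extend (suc i) c b σ) (numFaces-concatMap-extend i c b L) ⟩
    (δ (length σ) (suc i) + b * δ (length σ) i) + (numFaces (suc i) L + b * numFaces i L)
      ≡⟨ regroup (δ (length σ) (suc i)) (δ (length σ) i) (numFaces (suc i) L) (numFaces i L) b ⟩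
    (δ (length σ) (suc i) + numFaces (suc i) L) + b * (δ (length σ) i + numFaces i L)
      ≡⟨ cong₂ (λ x y → x + b * y) (numFaces-∷ (suc i) σ L) (numFaces-∷ i σ L) ⟨
    numFaces (suc i) (σ ∷ L) + b * numFaces i (σ ∷ L)
      ∎
    where
    regroup : ∀ x y u v b → (x + b * y) + (u + b * v) ≡ (x + u) + b * (y + v)
    regroup = solve-∀

  maxSize-nonempty : ∀ L → maxSize (filter nonempty L) ≡ maxSize L
  maxSize-nonempty []            = refl
  maxSize-nonempty ([] ∷ L)      = maxSize-nonempty L
  maxSize-nonempty (σ@(_ ∷ _) ∷ L) = cong (length σ ⊔_) (maxSize-nonempty L)

  maxSize-++ : ∀ L M → maxSize (L ++ M) ≡ maxSize L ⊔ maxSize M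
  maxSize-++ []      M = refl
  maxSize-++ (σ ∷ L) M = trans (cong (length σ ⊔_) (maxSize-++ L M)) (sym (ℕₚ.⊔-assoc (length σ) _ _))

  maxSize-map : ∀ l (g : ℕ → List ℕ) → (∀ v → length (g v) ≡ l) → ∀ v vs → maxSize (map g (v ∷ vs)) ≡ l
  maxSize-map l g len v []        = trans (ℕₚ.⊔-identityʳ (length (g v))) (len v)
  maxSize-map l g len v (w ∷ vs)  = trans (cong₂ _⊔_ (len v) (maxSize-map l g len w vs)) (ℕₚ.⊔-idem l)

  maxSize-extend : ∀ c b σ → maxSize (extend c (suc b) σ) ≡ suc (length σ)
  maxSize-extend c b σ = begin
    length σ ⊔ maxSize (map (λ v → σ ++ [ c + v ]) (upTo (suc b)))
      ≡⟨ cong (length σ ⊔_) (maxSize-map (suc (length σ)) (λ v → σ ++ [ c + v ]) (length-extension c σ)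
                                          0 (applyUpTo suc b)) ⟩
    length σ ⊔ suc (length σ)
      ≡⟨ ℕₚ.m≤n⇒m⊔n≡n (ℕₚ.n≤1+n (length σ)) ⟩
    suc (length σ)
      ∎

  maxSize-concatMap-extend : ∀ c b σ L →
                             maxSize (concatMap (extend c (suc b)) (σ ∷ L)) ≡ suc (maxSize (σ ∷ L))
  maxSize-concatMap-extend c b σ L = begin
    maxSize (extend c (suc b) σ ++ concatMap (extend c (suc b)) L)
      ≡⟨ maxSize-++ (extend c (suc b) σ) _ ⟩
    maxSize (extend c (suc b) σ) ⊔ maxSize (concatMap (extend c (suc b)) L)
      ≡⟨ cong (_⊔ maxSize (concatMap (extend c (suc b)) L)) (maxSize-extend c b σ) ⟩
    suc (length σ) ⊔ maxSize (concatMap (extend c (suc b)) L)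
      ≡⟨ suc-⊔-tail L ⟩
    suc (length σ ⊔ maxSize L)
      ∎
    where
    suc-⊔-tail : ∀ L →
                 suc (length σ) ⊔ maxSize (concatMap (extend c (suc b)) L) ≡ suc (length σ ⊔ maxSize L)
    suc-⊔-tail []      = cong suc (sym (ℕₚ.⊔-identityʳ (length σ)))
    suc-⊔-tail (τ ∷ L) = cong (suc (length σ) ⊔_) (maxSize-concatMap-extend c b τ L)

  rank-pts : ∀ a → rank (pts (suc a)) ≡ 1
  rank-pts a = maxSize-map 1 [_] (λ _ → refl) 0 (applyUpTo suc a)

  rank-join-pts : ∀ K b → rank (join K (pts (suc b))) ≡ suc (rank K)
  rank-join-pts K b = begin
    maxSize (faces (join K (pts (suc b))))
      ≡⟨ cong maxSize (faces-join-pts K (suc b)) ⟩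
    maxSize (filter nonempty (concatMap (extend (nverts K) (suc b)) ([] ∷ faces K)))
      ≡⟨ maxSize-nonempty (concatMap (extend (nverts K) (suc b)) ([] ∷ faces K)) ⟩
    maxSize (concatMap (extend (nverts K) (suc b)) ([] ∷ faces K))
      ≡⟨ maxSize-concatMap-extend (nverts K) b [] (faces K) ⟩
    suc (rank K)
      ∎

  rank-Δ : ∀ n a b → rank (Δ n (suc a) (suc b)) ≡ suc n
  rank-Δ zero    a b = rank-pts a
  rank-Δ (suc n) a b = trans (rank-join-pts (Δ n (suc a) (suc b)) b) (cong suc (rank-Δ n a b))

  numFaces-join-pts : ∀ i K b →
    numFaces (suc i) (faces (join K (pts b))) ≡ numFaces (suc i) ([] ∷ faces K) + b * numFaces i ([] ∷ faces K)
  numFaces-join-pts i K b = begin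
    numFaces (suc i) (faces (join K (pts b)))
      ≡⟨ cong (numFaces (suc i)) (faces-join-pts K b) ⟩
    numFaces (suc i) (filter nonempty (concatMap (extend (nverts K) b) ([] ∷ faces K)))
      ≡⟨ numFaces-nonempty i (concatMap (extend (nverts K) b) ([] ∷ faces K)) ⟩
    numFaces (suc i) (concatMap (extend (nverts K) b) ([] ∷ faces K))
      ≡⟨ numFaces-concatMap-extend i (nverts K) b ([] ∷ faces K) ⟩
    numFaces (suc i) ([] ∷ faces K) + b * numFaces i ([] ∷ faces K)
      ∎

  numFaces-zero-Δ : ∀ n a b → numFaces 0 (faces (Δ n a b)) ≡ 0
  numFaces-zero-Δ zero    a b = trans (numFaces-pts 0 a) (ℕₚ.*-zeroʳ a)
  numFaces-zero-Δ (suc n) a b =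
    trans (cong (numFaces 0) (faces-join-pts (Δ n a b) b))
          (numFaces-zero-nonempty (concatMap (extend (nverts (Δ n a b)) b) ([] ∷ faces (Δ n a b))))

module FVector where

  open import Data.Integer using (+_)
  import Data.Integer as ℤ
  import Data.Integer.Properties as ℤₚ
  open import Data.Nat using (_+_; _*_)
  open import Data.List using ([]; _∷_)
  open Coefficients using (one; mulOnePlus; mulOnePlus-zero; mulOnePlus-cong; fPolyΔ)
  open Faces using (numFaces; numFaces-pts; numFaces-join-pts; numFaces-zero-Δ)
  open ≡-Reasoning

  fExt-pts : ∀ a → (λ i → + fExt (pts a) i) ≗ mulOnePlus (+ a) one
  fExt-pts a zero    = sym (mulOnePlus-zero (+ a) one)
  fExt-pts a (suc i) = begin
    + fExt (pts a) (suc i)  ≡⟨ cong +_ (numFaces-pts (suc i) a) ⟩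
    + (a * δ 0 i)           ≡⟨ ℤₚ.pos-* a (δ 0 i) ⟩
    + a ℤ.* one i           ≡⟨ ℤₚ.+-identityˡ (+ a ℤ.* one i) ⟨
    mulOnePlus (+ a) one (suc i) ∎

  fExt-join-pts : ∀ K b → numFaces 0 (faces K) ≡ 0 →
                  (λ i → + fExt (join K (pts b)) i) ≗ mulOnePlus (+ b) (λ i → + fExt K i)
  fExt-join-pts K b noEmpty zero    = sym (mulOnePlus-zero (+ b) (λ i → + fExt K i))
  fExt-join-pts K b noEmpty (suc i) = begin
    + fExt (join K (pts b)) (suc i)
      ≡⟨ cong +_ (numFaces-join-pts i K b) ⟩
    + (fExt K (suc i) + b * numFaces i ([] ∷ faces K))
      ≡⟨ cong (λ n → + (fExt K (suc i) + b * n)) (withEmptyFace i) ⟩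
    + (fExt K (suc i) + b * fExt K i)
      ≡⟨ cong (λ x → + fExt K (suc i) ℤ.+ x) (ℤₚ.pos-* b (fExt K i)) ⟩
    + fExt K (suc i) ℤ.+ + b ℤ.* + fExt K i
      ∎
    where
    withEmptyFace : ∀ i → numFaces i ([] ∷ faces K) ≡ fExt K i
    withEmptyFace zero    = cong suc noEmpty
    withEmptyFace (suc i) = refl

  fExt-Δ : ∀ n a b → (λ i → + fExt (Δ n a b) i) ≗ fPolyΔ (+ a) (+ b) n
  fExt-Δ zero    a b = fExt-pts a
  fExt-Δ (suc n) a b i =
    trans (fExt-join-pts (Δ n a b) b (numFaces-zero-Δ n a b) i) (mulOnePlus-cong (+ b) (fExt-Δ n a b) i)

open import Data.Integer using (+_)
open Coefficients using (hTransform; hTransform-cong; hTransform-fPolyΔ; fPolyΔ; hFormula≡hTransform)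
open Faces using (rank-Δ)
open FVector using (fExt-Δ)

hCoeff-Δ : ∀ a b n j → j ≤ suc n → hCoeff (Δ n (suc a) (suc b)) j ≡ + fExt (Δ n a b) j
hCoeff-Δ a b n j j≤1+n = begin
  hCoeff K j
    ≡⟨ hFormula≡hTransform (rank K) j (fExt K) (subst (j ≤_) (sym (rank-Δ n a b)) j≤1+n) ⟩
  hTransform (rank K) (λ i → + fExt K i) j
    ≡⟨ cong (λ r → hTransform r (λ i → + fExt K i) j) (rank-Δ n a b) ⟩
  hTransform (suc n) (λ i → + fExt K i) j
    ≡⟨ hTransform-cong (suc n) (fExt-Δ n (suc a) (suc b)) j ⟩
  hTransform (suc n) (fPolyΔ (+ suc a) (+ suc b) n) j
    ≡⟨ hTransform-fPolyΔ (+ a) (+ b) n j ⟩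
  fPolyΔ (+ a) (+ b) n j
    ≡⟨ fExt-Δ n a b j ⟨
  + fExt (Δ n a b) j
    ∎
  where
  open ≡-Reasoning
  K : Complex
  K = Δ n (suc a) (suc b)

theorem5p5 : (m q : ℕ) → 2 ≤ m → 2 ≤ q → .{{_ : NonZero (q ∸ 1)}} →
    (i j : ℕ) → Hmat m q i j ≡ Ftilde (m ∸ 1) (q ∸ 1) i j
theorem5p5 (suc (suc a)) (suc (suc b)) (s≤s (s≤s _)) (s≤s (s≤s _)) zero    zero    = refl
theorem5p5 (suc (suc a)) (suc (suc b)) (s≤s (s≤s _)) (s≤s (s≤s _)) zero    (suc j) = refl
theorem5p5 (suc (suc a)) (suc (suc b)) (s≤s (s≤s _)) (s≤s (s≤s _)) (suc n) j
  rewrite rank-Δ n a b with j ≤? suc n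
... | yes j≤1+n = cong (ℚ._/ 1) (hCoeff-Δ (suc a) (suc b) n j j≤1+n)
... | no  _     = refl
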